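{- Let $R$ be a finite group with an abelian subgroup $M$ of index $2$, and let $\varphi$ be a non-identity automorphism of $R$ with $M^\varphi=M$. The number of subsets $S$ of $R\setminus M$ with $S^\varphi=S$ is at most $2^{\frac{3|R|}{8}}$. -}

module Defs where

open import Data.Nat using (ℕ; zero; suc)
open import Data.Bool using (Bool; true; false)
import Data.Bool.Properties as BoolP
open import Data.Fin using (Fin)
open import Data.Fin.Properties using (any?) renaming (_≟_ to _≟ᶠ_)
open import Data.Fin.Subset using (Subset; _∈_; _⊆_; ∁; inside; outside)
open import Data.Fin.Subset.Properties using (_∈?_; _⊆?_)
open import Data.Vec using (Vec; []; _∷_; tabulate)
import Data.Vec.Properties as VecP
open import Data.List using (List; []; _∷_; map; _++_; filter; length)
open import Data.Product using (_×_; _,_; ∃-syntax)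
open import Relation.Nullary using (Dec; does; _×-dec_)
open import Relation.Binary.PropositionalEquality using (_≡_)
open import Algebra.Structures using (IsGroup)

-- A finite group of order n, presented with carrier Fin n and
-- propositional equality (every finite group is isomorphic to such).
record FinGroup (n : ℕ) : Set where
  infixl 7 _∙_
  field
    _∙_     : Fin n → Fin n → Fin n
    ε       : Fin n
    _⁻¹     : Fin n → Fin n
    isGroup : IsGroup _≡_ _∙_ ε _⁻¹

record IsSubgroup {n : ℕ} (G : FinGroup n) (M : Subset n) : Set where
  open FinGroup G
  field
    ε∈     : ε ∈ M
    ∙-closed : ∀ {x y} → x ∈ M → y ∈ M → x ∙ y ∈ M
    ⁻¹-closed : ∀ {x} → x ∈ M → x ⁻¹ ∈ M

IsAbelianOn : {n : ℕ} (G : FinGroup n) (M : Subset n) → Set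
IsAbelianOn G M = ∀ {x y} → x ∈ M → y ∈ M → x ∙ y ≡ y ∙ x
  where open FinGroup G

record IsAutomorphism {n : ℕ} (G : FinGroup n) (φ : Fin n → Fin n) : Set where
  open FinGroup G
  field
    injective  : ∀ {x y} → φ x ≡ φ y → x ≡ y
    surjective : ∀ y → ∃[ x ] φ x ≡ y
    homo       : ∀ x y → φ (x ∙ y) ≡ φ x ∙ φ y

image : {n : ℕ} → (Fin n → Fin n) → Subset n → Subset n
image φ S = tabulate (λ y → does (any? (λ x → (x ∈? S) ×-dec (φ x ≟ᶠ y))))

allSubsets : (n : ℕ) → List (Subset n)
allSubsets zero = [] ∷ []
allSubsets (suc n) = map (outside ∷_) (allSubsets n) ++ map (inside ∷_) (allSubsets n)

_≟ˢ_ : {n : ℕ} (S T : Subset n) → Dec (S ≡ T)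
_≟ˢ_ = VecP.≡-dec BoolP._≟_

Good : {n : ℕ} → (Fin n → Fin n) → Subset n → Subset n → Set
Good φ M S = (S ⊆ ∁ M) × (image φ S ≡ S)

good? : {n : ℕ} (φ : Fin n → Fin n) (M S : Subset n) → Dec (Good φ M S)
good? φ M S = (S ⊆? ∁ M) ×-dec (image φ S ≟ˢ S)

countGood : {n : ℕ} → (Fin n → Fin n) → Subset n → ℕ
countGood {n} φ M = length (filter (good? φ M) (allSubsets n))

-- Let X = R ∖ M and let F be the fixed points of φ, a subgroup of R. If more than half of X
-- were fixed, then for each a ∈ M the sets F ∩ X and a(F ∩ X) ⊆ X would meet, forcing a ∈ F;
-- then |F| ≥ |M| + |F ∩ X| > |R|/2 and the same argument gives F = R. So |F ∩ X| ≤ |X|/2.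
--
-- Instead of counting orbits, call x ∈ X a local minimum if x ≤ φ x and x ≤ φ⁻¹ x in the
-- order of Fin n. A φ-invariant set is determined by its local minima (induction on that
-- order), and φ maps the non-fixed local minima injectively to non-fixed points that are not
-- local minima. Hence 2 |T| ≤ |X| + |F ∩ X| ≤ 3|X|/2 for the set T of local minima, and the
-- number of invariant S ⊆ X is at most 2^|T| ≤ 2^(3|R|/8).
module Submission where

open import Defs
open import Data.Nat using (ℕ; zero; suc; _+_; _*_; _^_; _≤_; _<_; z≤n; s≤s)
import Data.Nat.Properties as ℕ
open import Data.Nat.Tactic.RingSolver using (solve-∀)
open import Data.Bool using (if_then_else_)
open import Data.Fin using (Fin; zero; suc) renaming (_≤_ to _≤ᶠ_)
open import Data.Fin.Properties using (any?; _≤?_)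
  renaming (_≟_ to _≟ᶠ_; ≤-antisym to ≤ᶠ-antisym)
open import Data.Fin.Induction using (<-wellFounded)
open import Data.Fin.Permutation
  using (Permutation′; permutation; _⟨$⟩ʳ_; _⟨$⟩ˡ_; inverseˡ; inverseʳ)
open import Data.Fin.Subset using (Subset; ∣_∣; _∈_; _⊆_; inside; outside)
  renaming (_∩_ to _∩ˢ_)
open import Data.Fin.Subset.Properties
  using (_∈?_; drop-∷-⊆; p∩q⊆q; ⊆-antisym; x∈∁p⇒x∉p; x∈p∩q⁺; x∈p∩q⁻)
open import Data.Vec using ([]; _∷_; tabulate; here)
open import Data.Vec.Properties using (∷-injectiveʳ; lookup∘tabulate; lookup⇒[]=; []=⇒lookup)
open import Data.List using (List; []; _∷_; map; _++_; filter; length)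
open import Data.List.Properties using (length-map; length-++; length-removeAt′)
open import Data.List.Membership.Propositional using () renaming (_∈_ to _∈ₗ_)
open import Data.List.Membership.Propositional.Properties
  using (∈-map⁺; ∈-map⁻; ∈-++⁺ˡ; ∈-++⁺ʳ; ∈-filter⁻)
open import Data.List.Relation.Unary.Any using (here; there; _─_)
import Data.List.Relation.Unary.All as All
open import Data.List.Relation.Unary.AllPairs using ([]; _∷_)
open import Data.List.Relation.Unary.Unique.Propositional using (Unique)
import Data.List.Relation.Unary.Unique.Propositional.Properties as Unique
open import Data.Product using (_×_; _,_; ∃-syntax; proj₁; proj₂)
open import Function using (_∘_; _⇔_; mk⇔; Equivalence)
open import Induction.WellFounded using (Acc; acc)
open import Level using (Level; 0ℓ)
open import Relation.Nullary using (Dec; does; yes; no; ¬_; _×-dec_; contradiction)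
open import Relation.Nullary.Decidable using (dec-true)
open import Relation.Unary using (Pred; Decidable; _∩_; ∁; U; Satisfiable)
  renaming (_⊆_ to _⊆ₚ_)
open import Relation.Unary.Properties using (_∩?_; ∁?; U?)
open import Relation.Binary.PropositionalEquality
  using (_≡_; _≢_; refl; sym; trans; cong; cong₂; subst; module ≡-Reasoning)
open import Algebra.Bundles using (Group)
open import Algebra.Structures using (IsGroup)
import Algebra.Properties.Group as GroupProperties
open import Algebra.Properties.CommutativeMonoid.Sum ℕ.+-0-commutativeMonoid
  using (sum; sum-permute)

private
  variable
    n : ℕ
    ℓ ℓ′ ℓ″ : Level
    A B : Set

indicator : ∀ {a} {A : Set a} → Dec A → ℕ
indicator a? = if does a? then 1 else 0

count : {P : Pred (Fin n) ℓ} → Decidable P → ℕ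
count P? = sum (indicator ∘ P?)

count-mono : {P : Pred (Fin n) ℓ} {Q : Pred (Fin n) ℓ′} (P? : Decidable P) (Q? : Decidable Q) →
             P ⊆ₚ Q → count P? ≤ count Q?
count-mono {n = zero}  P? Q? P⊆Q = z≤n
count-mono {n = suc n} P? Q? P⊆Q with P? zero | Q? zero
... | yes _ | yes _ = s≤s (count-mono (P? ∘ suc) (Q? ∘ suc) P⊆Q)
... | yes p | no ¬q = contradiction (P⊆Q p) ¬q
... | no _  | yes _ = ℕ.m≤n⇒m≤1+n (count-mono (P? ∘ suc) (Q? ∘ suc) P⊆Q)
... | no _  | no _  = count-mono (P? ∘ suc) (Q? ∘ suc) P⊆Q

count-∩-∁ : {P : Pred (Fin n) ℓ} {Q : Pred (Fin n) ℓ′} (P? : Decidable P) (Q? : Decidable Q) →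
            count (P? ∩? Q?) + count (P? ∩? ∁? Q?) ≡ count P?
count-∩-∁ {n = zero}  P? Q? = refl
count-∩-∁ {n = suc n} P? Q? with P? zero | Q? zero
... | yes _ | yes _ = cong suc (count-∩-∁ (P? ∘ suc) (Q? ∘ suc))
... | yes _ | no _  = trans (ℕ.+-suc _ _) (cong suc (count-∩-∁ (P? ∘ suc) (Q? ∘ suc)))
... | no _  | _     = count-∩-∁ (P? ∘ suc) (Q? ∘ suc)

count-U : count (U? {A = Fin n}) ≡ n
count-U {n = zero}  = refl
count-U {n = suc n} = cong suc count-U

count-∁ : {P : Pred (Fin n) ℓ} (P? : Decidable P) → count P? + count (∁? P?) ≡ n
count-∁ P? = trans (count-∩-∁ U? P?) count-U

count-permute : {P : Pred (Fin n) ℓ} (π : Permutation′ n) (P? : Decidable P) →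
                count (P? ∘ (π ⟨$⟩ʳ_)) ≡ count P?
count-permute π P? = sym (sum-permute (indicator ∘ P?) π)

∩-satisfiable : {P : Pred (Fin n) ℓ} {Q : Pred (Fin n) ℓ′} {R : Pred (Fin n) ℓ″}
                (P? : Decidable P) (Q? : Decidable Q) (R? : Decidable R) → P ⊆ₚ R → Q ⊆ₚ R →
                count R? < count P? + count Q? → Satisfiable (P ∩ Q)
∩-satisfiable P? Q? R? P⊆R Q⊆R R<P+Q with any? (P? ∩? Q?)
... | yes P∩Q = P∩Q
... | no ¬P∩Q = contradiction P+Q≤R (ℕ.<⇒≱ R<P+Q)
  where
  P≤R∖Q : count P? ≤ count (R? ∩? ∁? Q?)
  P≤R∖Q = count-mono P? (R? ∩? ∁? Q?) λ p → P⊆R p , λ q → ¬P∩Q (_ , p , q)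
  Q≤R∩Q : count Q? ≤ count (R? ∩? Q?)
  Q≤R∩Q = count-mono Q? (R? ∩? Q?) λ q → Q⊆R q , q
  P+Q≤R : count P? + count Q? ≤ count R?
  P+Q≤R = ℕ.≤-trans (ℕ.+-mono-≤ P≤R∖Q Q≤R∩Q)
    (ℕ.≤-reflexive (trans (ℕ.+-comm (count (R? ∩? ∁? Q?)) _) (count-∩-∁ R? Q?)))

count-∈ : (S : Subset n) → count (_∈? S) ≡ ∣ S ∣
count-∈ []            = refl
count-∈ (inside ∷ S)  = cong suc (count-∈ S)
count-∈ (outside ∷ S) = count-∈ S

toSubset : {P : Pred (Fin n) ℓ} → Decidable P → Subset n
toSubset P? = tabulate (does ∘ P?)

∣toSubset∣ : {P : Pred (Fin n) ℓ} (P? : Decidable P) → ∣ toSubset P? ∣ ≡ count P?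
∣toSubset∣ {n = zero}  P? = refl
∣toSubset∣ {n = suc n} P? with P? zero
... | yes _ = cong suc (∣toSubset∣ (P? ∘ suc))
... | no _  = ∣toSubset∣ (P? ∘ suc)

∈-toSubset⁺ : {P : Pred (Fin n) ℓ} (P? : Decidable P) {x : Fin n} → P x → x ∈ toSubset P?
∈-toSubset⁺ P? {x} px = lookup⇒[]= x _ (trans (lookup∘tabulate _ x) (dec-true (P? x) px))

module _ (φ : Fin n → Fin n) {S : Subset n} where

  ∈-image⁺ : ∀ {x} → x ∈ S → φ x ∈ image φ S
  ∈-image⁺ {x} x∈S =
    lookup⇒[]= (φ x) _ (trans (lookup∘tabulate _ (φ x)) (dec-true (any? _) (x , x∈S , refl)))

  ∈-image⁻ : ∀ {y} → y ∈ image φ S → ∃[ x ] x ∈ S × φ x ≡ y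
  ∈-image⁻ {y} y∈ with any? (λ x → (x ∈? S) ×-dec (φ x ≟ᶠ y))
                     | trans (sym (lookup∘tabulate _ y)) ([]=⇒lookup y∈)
  ... | yes preimage | _ = preimage
  ... | no _         | ()

  image-invariant⇒∈⇔ : (∀ {x y} → φ x ≡ φ y → x ≡ y) → image φ S ≡ S → ∀ {x} → x ∈ S ⇔ φ x ∈ S
  image-invariant⇒∈⇔ injective φS≡S = mk⇔ (subst (_ ∈_) φS≡S ∘ ∈-image⁺) from
    where
    from : ∀ {x} → φ x ∈ S → x ∈ S
    from φx∈S with ∈-image⁻ (subst (_ ∈_) (sym φS≡S) φx∈S)
    ... | z , z∈S , φz≡φx = subst (_∈ S) (injective φz≡φx) z∈S

∈-─⁺ : ∀ {xs : List A} {x y} (x∈xs : x ∈ₗ xs) → y ∈ₗ xs → y ≢ x → y ∈ₗ (xs ─ x∈xs)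
∈-─⁺ (here refl)  (here refl)  y≢x = contradiction refl y≢x
∈-─⁺ (here refl)  (there y∈xs) y≢x = y∈xs
∈-─⁺ (there _)    (here refl)  y≢x = here refl
∈-─⁺ (there x∈xs) (there y∈xs) y≢x = there (∈-─⁺ x∈xs y∈xs y≢x)

length-≤-injectiveOn : ∀ (f : A → B) {xs ys} → Unique xs → (∀ {x} → x ∈ₗ xs → f x ∈ₗ ys) →
                       (∀ {x y} → x ∈ₗ xs → y ∈ₗ xs → f x ≡ f y → x ≡ y) →
                       length xs ≤ length ys
length-≤-injectiveOn f {[]}     _ _ _ = z≤n
length-≤-injectiveOn f {x ∷ xs} {ys} (x∉xs ∷ xs-unique) into inj =
  subst (length (x ∷ xs) ≤_) (sym (length-removeAt′ ys _))
    (s≤s (length-≤-injectiveOn f xs-unique into′ λ y∈ z∈ → inj (there y∈) (there z∈)))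
  where
  fx∈ys : f x ∈ₗ ys
  fx∈ys = into (here refl)
  into′ : ∀ {y} → y ∈ₗ xs → f y ∈ₗ (ys ─ fx∈ys)
  into′ y∈xs = ∈-─⁺ fx∈ys (into (there y∈xs))
    λ fy≡fx → All.lookup x∉xs y∈xs (sym (inj (there y∈xs) (here refl) fy≡fx))

allSubsets-unique : (n : ℕ) → Unique (allSubsets n)
allSubsets-unique zero    = All.[] ∷ []
allSubsets-unique (suc n) = Unique.++⁺ (Unique.map⁺ ∷-injectiveʳ (allSubsets-unique n))
                                       (Unique.map⁺ ∷-injectiveʳ (allSubsets-unique n)) disjoint
  where
  disjoint : ∀ {S} → ¬ (S ∈ₗ map (outside ∷_) (allSubsets n) × S ∈ₗ map (inside ∷_) (allSubsets n))
  disjoint (S∈out , S∈in) with ∈-map⁻ (outside ∷_) S∈out | ∈-map⁻ (inside ∷_) S∈in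
  ... | _ , _ , refl | _ , _ , ()

subsetsOf : Subset n → List (Subset n)
subsetsOf []            = [] ∷ []
subsetsOf (outside ∷ T) = map (outside ∷_) (subsetsOf T)
subsetsOf (inside ∷ T)  = map (outside ∷_) (subsetsOf T) ++ map (inside ∷_) (subsetsOf T)

length-subsetsOf : (T : Subset n) → length (subsetsOf T) ≡ 2 ^ ∣ T ∣
length-subsetsOf []            = refl
length-subsetsOf (outside ∷ T) = trans (length-map _ (subsetsOf T)) (length-subsetsOf T)
length-subsetsOf (inside ∷ T)  = begin
  length (map (outside ∷_) (subsetsOf T) ++ map (inside ∷_) (subsetsOf T))
    ≡⟨ length-++ (map (outside ∷_) (subsetsOf T)) ⟩
  length (map (outside ∷_) (subsetsOf T)) + length (map (inside ∷_) (subsetsOf T))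
    ≡⟨ cong₂ _+_ (length-map _ (subsetsOf T)) (length-map _ (subsetsOf T)) ⟩
  length (subsetsOf T) + length (subsetsOf T)
    ≡⟨ cong₂ _+_ (length-subsetsOf T) (trans (length-subsetsOf T) (sym (ℕ.+-identityʳ _))) ⟩
  2 ^ suc ∣ T ∣
    ∎
  where open ≡-Reasoning

∈-subsetsOf : {S T : Subset n} → S ⊆ T → S ∈ₗ subsetsOf T
∈-subsetsOf {S = []}          {[]}          _   = here refl
∈-subsetsOf {S = outside ∷ S} {outside ∷ T} S⊆T = ∈-map⁺ _ (∈-subsetsOf (drop-∷-⊆ S⊆T))
∈-subsetsOf {S = outside ∷ S} {inside ∷ T}  S⊆T = ∈-++⁺ˡ (∈-map⁺ _ (∈-subsetsOf (drop-∷-⊆ S⊆T)))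
∈-subsetsOf {S = inside ∷ S}  {inside ∷ T}  S⊆T = ∈-++⁺ʳ _ (∈-map⁺ _ (∈-subsetsOf (drop-∷-⊆ S⊆T)))
∈-subsetsOf {S = inside ∷ S}  {outside ∷ T} S⊆T with () ← S⊆T here

DeterminedOn : Subset n → Pred (Subset n) ℓ → Set ℓ
DeterminedOn T P = ∀ {S S′} → P S → P S′ → S ∩ˢ T ≡ S′ ∩ˢ T → S ≡ S′

length-filter-allSubsets-≤ : {P : Pred (Subset n) ℓ} (P? : Decidable P) (T : Subset n) →
                             DeterminedOn T P → length (filter P? (allSubsets n)) ≤ 2 ^ ∣ T ∣
length-filter-allSubsets-≤ {n} {P = P} P? T determined =
  subst (_ ≤_) (length-subsetsOf T)
    (length-≤-injectiveOn (_∩ˢ T) (Unique.filter⁺ P? (allSubsets-unique n))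
      (λ {S} _ → ∈-subsetsOf (p∩q⊆q S T))
      λ S∈ S′∈ → determined (satisfies S∈) (satisfies S′∈))
  where
  satisfies : ∀ {S} → S ∈ₗ filter P? (allSubsets n) → P S
  satisfies = proj₂ ∘ ∈-filter⁻ P? {xs = allSubsets n}

module _ (π : Permutation′ n) where

  private
    φ ψ : Fin n → Fin n
    φ = π ⟨$⟩ʳ_
    ψ = π ⟨$⟩ˡ_

  Fixed : Pred (Fin n) _
  Fixed x = φ x ≡ x

  fixed? : Decidable Fixed
  fixed? x = φ x ≟ᶠ x

  LocalMin : Pred (Fin n) _
  LocalMin x = x ≤ᶠ φ x × x ≤ᶠ ψ x

  localMin? : Decidable LocalMin
  localMin? x = (x ≤? φ x) ×-dec (x ≤? ψ x)

  Invariant : Subset n → Set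
  Invariant S = ∀ {x} → x ∈ S ⇔ φ x ∈ S

  φ-injective : ∀ {x y} → φ x ≡ φ y → x ≡ y
  φ-injective φx≡φy = trans (sym (inverseˡ π)) (trans (cong ψ φx≡φy) (inverseˡ π))

  ⊆-fromLocalMin : {S S′ : Subset n} → Invariant S → Invariant S′ →
                   (∀ {x} → LocalMin x → x ∈ S → x ∈ S′) → S ⊆ S′
  ⊆-fromLocalMin {S} {S′} inv inv′ onLocalMin {x} = go x (<-wellFounded x)
    where
    open Equivalence
    go : ∀ x → Acc _ x → x ∈ S → x ∈ S′
    go x (acc smaller) x∈S with x ≤? φ x | x ≤? ψ x
    ... | yes x≤φx | yes x≤ψx = onLocalMin (x≤φx , x≤ψx) x∈S
    ... | no x≰φx  | _        = from inv′ (go (φ x) (smaller (ℕ.≰⇒> x≰φx)) (to inv x∈S))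
    ... | yes _    | no x≰ψx  = subst (_∈ S′) (inverseʳ π)
      (to inv′ (go (ψ x) (smaller (ℕ.≰⇒> x≰ψx)) (from inv (subst (_∈ S) (sym (inverseʳ π)) x∈S))))

  count-localMin : {X : Pred (Fin n) ℓ} (X? : Decidable X) → (∀ {x} → X x → X (φ x)) →
                   2 * count (X? ∩? localMin?) ≤ count X? + count (X? ∩? fixed?)
  count-localMin {X = X} X? X-closed = begin
    2 * t              ≤⟨ ℕ.*-monoʳ-≤ 2 t≤a+b ⟩
    2 * (a + b)        ≡⟨ regroup a b ⟩
    a + (a + (b + b))  ≤⟨ ℕ.+-monoʳ-≤ a (ℕ.+-monoʳ-≤ a (ℕ.+-monoʳ-≤ b b≤c)) ⟩
    a + (a + (b + c))  ≡⟨ cong (a +_) a+b+c≡X ⟩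
    a + count X?       ≡⟨ ℕ.+-comm a _ ⟩
    count X? + a       ∎
    where
    open ℕ.≤-Reasoning
    moved? : Decidable (X ∩ ∁ Fixed)
    moved? = X? ∩? ∁? fixed?
    t a b c : ℕ
    t = count (X? ∩? localMin?)
    a = count (X? ∩? fixed?)
    b = count (moved? ∩? localMin?)
    c = count (moved? ∩? ∁? localMin?)
    regroup : ∀ a b → 2 * (a + b) ≡ a + (a + (b + b))
    regroup = solve-∀
    t≤a+b : t ≤ a + b
    t≤a+b = begin
      t  ≡⟨ count-∩-∁ (X? ∩? localMin?) fixed? ⟨
      count ((X? ∩? localMin?) ∩? fixed?) + count ((X? ∩? localMin?) ∩? ∁? fixed?)
         ≤⟨ ℕ.+-mono-≤
              (count-mono ((X? ∩? localMin?) ∩? fixed?) (X? ∩? fixed?) λ ((x , _) , f) → x , f)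
              (count-mono ((X? ∩? localMin?) ∩? ∁? fixed?) (moved? ∩? localMin?)
                 λ ((x , l) , ¬f) → (x , ¬f) , l) ⟩
      a + b  ∎
    φ-leaves-localMin : ∀ {x} → ((X ∩ ∁ Fixed) ∩ LocalMin) x → ((X ∩ ∁ Fixed) ∩ ∁ LocalMin) (φ x)
    φ-leaves-localMin {x} ((Xx , ¬fixed) , x≤φx , _) =
      (X-closed Xx , ¬fixed ∘ φ-injective) , λ (_ , φx≤ψφx) →
        ¬fixed (≤ᶠ-antisym (subst (φ x ≤ᶠ_) (inverseˡ π) φx≤ψφx) x≤φx)
    b≤c : b ≤ c
    b≤c = ℕ.≤-trans (count-mono (moved? ∩? localMin?) ((moved? ∩? ∁? localMin?) ∘ φ) φ-leaves-localMin)
                    (ℕ.≤-reflexive (count-permute π (moved? ∩? ∁? localMin?)))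
    a+b+c≡X : a + (b + c) ≡ count X?
    a+b+c≡X = trans (cong (a +_) (count-∩-∁ moved? localMin?)) (count-∩-∁ X? fixed?)

module _ (G : FinGroup n) {φ : Fin n → Fin n} (aut : IsAutomorphism G φ) where

  open FinGroup G
  open IsGroup isGroup using (_\\_)
  open IsAutomorphism aut

  private
    group : Group 0ℓ 0ℓ
    group = record { isGroup = isGroup }

  open GroupProperties group using (\\-leftDividesˡ; \\-leftDividesʳ; ∙-cancelʳ)

  automorphism : Permutation′ n
  automorphism =
    permutation φ (proj₁ ∘ surjective) (proj₂ ∘ surjective) (injective ∘ proj₂ ∘ surjective ∘ φ)

  leftDivision : Fin n → Permutation′ n
  leftDivision a = permutation (a \\_) (a ∙_) (\\-leftDividesʳ a) (\\-leftDividesˡ a)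

  fixed-cancelʳ : ∀ a b → φ b ≡ b → φ (a ∙ b) ≡ a ∙ b → φ a ≡ a
  fixed-cancelʳ a b φb≡b φab≡ab = ∙-cancelʳ b (φ a) a (begin
    φ a ∙ b    ≡⟨ cong (φ a ∙_) φb≡b ⟨
    φ a ∙ φ b  ≡⟨ homo a b ⟨
    φ (a ∙ b)  ≡⟨ φab≡ab ⟩
    a ∙ b      ∎)
    where open ≡-Reasoning

  more-than-half-fixed⇒fixed : ∀ a {C : Pred (Fin n) ℓ} (C? : Decidable C) → (∀ {y} → C (a \\ y) → C y) →
                               count C? < 2 * count (C? ∩? fixed? automorphism) → φ a ≡ a
  more-than-half-fixed⇒fixed a {C} C? C-closed C<2F =
    fixed-at-meet (∩-satisfiable F? (F? ∘ (a \\_)) C? proj₁ (C-closed ∘ proj₁) C<F+aF)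
    where
    F? : Decidable (C ∩ Fixed automorphism)
    F? = C? ∩? fixed? automorphism
    C<F+aF : count C? < count F? + count (F? ∘ (a \\_))
    C<F+aF = subst (count C? <_)
      (cong (count F? +_) (trans (ℕ.+-identityʳ _) (sym (count-permute (leftDivision a) F?)))) C<2F
    fixed-at-meet : Satisfiable ((C ∩ Fixed automorphism) ∩ ((C ∩ Fixed automorphism) ∘ (a \\_))) →
                    φ a ≡ a
    fixed-at-meet (y , (_ , φy≡y) , (_ , φa\\y≡a\\y)) =
      fixed-cancelʳ a (a \\ y) φa\\y≡a\\y (subst (λ z → φ z ≡ z) (sym (\\-leftDividesˡ a y)) φy≡y)

t*8≤3*[2*m] : ∀ t f m → 2 * t ≤ m + f → 2 * f ≤ m → t * 8 ≤ 3 * (2 * m)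
t*8≤3*[2*m] t f m 2t≤m+f 2f≤m = begin
  t * 8                ≡⟨ regroupˡ t ⟩
  4 * (2 * t)          ≤⟨ ℕ.*-monoʳ-≤ 4 2t≤m+f ⟩
  4 * (m + f)          ≡⟨ regroupᵐ m f ⟩
  4 * m + 2 * (2 * f)  ≤⟨ ℕ.+-monoʳ-≤ (4 * m) (ℕ.*-monoʳ-≤ 2 2f≤m) ⟩
  4 * m + 2 * m        ≡⟨ regroupʳ m ⟩
  3 * (2 * m)          ∎
  where
  open ℕ.≤-Reasoning
  regroupˡ : ∀ t → t * 8 ≡ 4 * (2 * t)
  regroupˡ = solve-∀
  regroupᵐ : ∀ m f → 4 * (m + f) ≡ 4 * m + 2 * (2 * f)
  regroupᵐ = solve-∀
  regroupʳ : ∀ m → 4 * m + 2 * m ≡ 3 * (2 * m)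
  regroupʳ = solve-∀

module IndexTwoSubgroup (R : FinGroup n) {M : Subset n} (M≤R : IsSubgroup R M) (index2 : 2 * ∣ M ∣ ≡ n)
                        {φ : Fin n → Fin n} (aut : IsAutomorphism R φ) (M-invariant : image φ M ≡ M)
                        where

  open FinGroup R
  open IsSubgroup M≤R
  open IsAutomorphism aut using (injective)

  private
    π : Permutation′ n
    π = automorphism R aut

    m : ℕ
    m = ∣ M ∣

    everything? : Decidable {A = Fin n} U
    everything? = U?

  outside? : Decidable (∁ (_∈ M))
  outside? = ∁? (_∈? M)

  fixedOutside : ℕ
  fixedOutside = count (outside? ∩? fixed? π)

  count-outside : count outside? ≡ m
  count-outside = ℕ.+-cancelˡ-≡ m _ _ (begin
    m + count outside?              ≡⟨ cong (_+ count outside?) (count-∈ M) ⟨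
    count (_∈? M) + count outside?  ≡⟨ count-∁ (_∈? M) ⟩
    n                               ≡⟨ index2 ⟨
    2 * m                           ≡⟨ cong (m +_) (ℕ.+-identityʳ m) ⟩
    m + m                           ∎)
    where open ≡-Reasoning

  module _ (m<2f : m < 2 * fixedOutside) where

    fixed-on-M : ∀ {a} → a ∈ M → φ a ≡ a
    fixed-on-M a∈M = more-than-half-fixed⇒fixed R aut _ outside?
      (λ a\\y∉M y∈M → a\\y∉M (∙-closed (⁻¹-closed a∈M) y∈M))
      (subst (_< 2 * fixedOutside) (sym count-outside) m<2f)

    m+f≤count-fixed : m + fixedOutside ≤ count (everything? ∩? fixed? π)
    m+f≤count-fixed = begin
      m + fixedOutside                                ≡⟨ cong (_+ fixedOutside) (count-∈ M) ⟨
      count (_∈? M) + fixedOutside                    ≤⟨ ℕ.+-mono-≤ fixed-in-M fixed-outside-M ⟩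
      count (F? ∩? (_∈? M)) + count (F? ∩? outside?)  ≡⟨ count-∩-∁ F? (_∈? M) ⟩
      count F?                                        ∎
      where
      open ℕ.≤-Reasoning
      F? : Decidable (U ∩ Fixed π)
      F? = everything? ∩? fixed? π
      fixed-in-M : count (_∈? M) ≤ count (F? ∩? (_∈? M))
      fixed-in-M = count-mono (_∈? M) (F? ∩? (_∈? M)) λ a∈M → (_ , fixed-on-M a∈M) , a∈M
      fixed-outside-M : fixedOutside ≤ count (F? ∩? outside?)
      fixed-outside-M = count-mono (outside? ∩? fixed? π) (F? ∩? outside?) λ (a∉M , fixed) → (_ , fixed) , a∉M

    fixed-everywhere : ∀ a → φ a ≡ a
    fixed-everywhere a = more-than-half-fixed⇒fixed R aut a everything? (λ _ → _) (begin-strict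
      count everything?                    ≡⟨ count-U ⟩
      n                                    ≡⟨ index2 ⟨
      2 * m                                ≤⟨ ℕ.m≤m+n (2 * m) m ⟩
      2 * m + m                            <⟨ ℕ.+-monoʳ-< (2 * m) m<2f ⟩
      2 * m + 2 * fixedOutside             ≡⟨ ℕ.*-distribˡ-+ 2 m fixedOutside ⟨
      2 * (m + fixedOutside)               ≤⟨ ℕ.*-monoʳ-≤ 2 m+f≤count-fixed ⟩
      2 * count (everything? ∩? fixed? π)  ∎)
      where open ℕ.≤-Reasoning

  2*fixedOutside≤ : ¬ (∀ x → φ x ≡ x) → 2 * fixedOutside ≤ m
  2*fixedOutside≤ φ≢id = ℕ.≮⇒≥ (φ≢id ∘ fixed-everywhere)

  outsideLocalMin? : Decidable (∁ (_∈ M) ∩ LocalMin π)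
  outsideLocalMin? = outside? ∩? localMin? π

  2*count-outsideLocalMin≤ : 2 * count outsideLocalMin? ≤ m + fixedOutside
  2*count-outsideLocalMin≤ = subst (λ k → 2 * count outsideLocalMin? ≤ k + fixedOutside) count-outside
    (count-localMin π outside? λ x∉M φx∈M → x∉M (Equivalence.from M-invariant⇔ φx∈M))
    where
    M-invariant⇔ : ∀ {x} → x ∈ M ⇔ φ x ∈ M
    M-invariant⇔ = image-invariant⇒∈⇔ φ injective M-invariant

  good-determinedOn-outsideLocalMin : DeterminedOn (toSubset outsideLocalMin?) (Good φ M)
  good-determinedOn-outsideLocalMin good good′ S∩T≡S′∩T =
    ⊆-antisym (⊆-of-∩ good good′ S∩T≡S′∩T) (⊆-of-∩ good′ good (sym S∩T≡S′∩T))
    where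
    T : Subset n
    T = toSubset outsideLocalMin?
    ⊆-of-∩ : ∀ {S S′} → Good φ M S → Good φ M S′ → S ∩ˢ T ≡ S′ ∩ˢ T → S ⊆ S′
    ⊆-of-∩ (S⊆∁M , φS≡S) (_ , φS′≡S′) S∩T≡S′∩T =
      ⊆-fromLocalMin π (image-invariant⇒∈⇔ φ injective φS≡S) (image-invariant⇒∈⇔ φ injective φS′≡S′)
        λ localMin x∈S →
          let x∈T = ∈-toSubset⁺ outsideLocalMin? (x∈∁p⇒x∉p (S⊆∁M x∈S) , localMin)
          in  proj₁ (x∈p∩q⁻ _ _ (subst (_ ∈_) S∩T≡S′∩T (x∈p∩q⁺ (x∈S , x∈T))))

  countGood≤ : countGood φ M ≤ 2 ^ count outsideLocalMin?
  countGood≤ = subst (λ k → countGood φ M ≤ 2 ^ k) (∣toSubset∣ outsideLocalMin?)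
    (length-filter-allSubsets-≤ (good? φ M) (toSubset outsideLocalMin?)
       good-determinedOn-outsideLocalMin)

lemma2p2 : (n : ℕ) (R : FinGroup n) (M : Subset n) → IsSubgroup R M → IsAbelianOn R M → 2 * ∣ M ∣ ≡ n → (φ : Fin n → Fin n) → IsAutomorphism R φ → ¬ (∀ x → φ x ≡ x) → image φ M ≡ M → countGood φ M ^ 8 ≤ 2 ^ (3 * n)
lemma2p2 n R M M≤R _ index2 φ aut φ≢id M-invariant = begin
  countGood φ M ^ 8      ≤⟨ ℕ.^-monoˡ-≤ 8 countGood≤ ⟩
  (2 ^ t) ^ 8            ≡⟨ ℕ.^-*-assoc 2 t 8 ⟩
  2 ^ (t * 8)            ≤⟨ ℕ.^-monoʳ-≤ 2 (t*8≤3*[2*m] t fixedOutside ∣ M ∣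
                                          2*count-outsideLocalMin≤ (2*fixedOutside≤ φ≢id)) ⟩
  2 ^ (3 * (2 * ∣ M ∣))  ≡⟨ cong (λ k → 2 ^ (3 * k)) index2 ⟩
  2 ^ (3 * n)            ∎
  where
  open ℕ.≤-Reasoning
  open IndexTwoSubgroup R M≤R index2 aut M-invariant
  t : ℕ
  t = count outsideLocalMin?
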